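{- For $N\ge 1$ let $Z^{\mathrm{ch}}_N$ be the number of charge(3) configurations on the box $[1,N]^2$ and let $Z^{Q}_N$ be the number of $Q$-charge configurations on the box $[1,N]^2$ (both defined below). Then the growth rates of the two models are equal: $$\lim_{N\to\infty}\big(Z^{\mathrm{ch}}_N\big)^{1/N^2}=\lim_{N\to\infty}\big(Z^{Q}_N\big)^{1/N^2}.$$
   Context: A charge(3) configuration on $[1,N]^2$ is an assignment of a spin $s(v)\in\{+1,-1\}$ to each vertex $v$ of $[1,N]^2\subset\mathbb{Z}^2$ such that for every finite horizontal or vertical line segment of consecutive vertices inside the box, the sum of the spins along that segment lies in $[-3,3]$ (equivalently, along each row read from west to east and each column read from north to south there is an initial value in $\{0,1,2,3\}$ such that all cumulative sums stay in $\{0,1,2,3\}$). A $Q$-charge configuration on $[1,N]^2$ assigns to each bond of the box, including the dangling boundary bonds (so every vertex of the box has four incident bonds: north, west, east, south), a state in $\{0,1,2,3\}$ such that at every vertex, if $a,b,c,d$ are the states of its north, west, east and south bonds respectively, then $d-a=c-b\in\{+1,-1\}$. (Intuitively, the state of a horizontal/vertical bond is the cumulative charge after reading the spin to its west/north.) The growth rate of a model is $\kappa=\lim_{N\to\infty} Z_N^{1/N^2}$, where $Z_N$ is the number of its configurations on $[1,N]^2$; these limits are taken to exist. -}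

module Defs where

open import Data.Bool using (Bool; true; false; _∧_)
open import Data.Nat as ℕ using (ℕ; zero; suc; _≤_; _<_; _^_)
import Data.Nat as N
open import Data.Integer as ℤ using (ℤ; +_; -[1+_])
open import Data.Fin using (Fin; toℕ; inject₁) renaming (suc to fsuc)
open import Data.List as L using (List; []; _∷_; _++_; inits; allFin; concatMap; filterᵇ; length; cartesianProduct)
open import Data.Bool.ListAction using (all)
open import Data.Vec as V using (Vec; lookup; toList; transpose)
open import Data.Product using (_×_; _,_; ∃)
open import Relation.Nullary.Decidable using (⌊_⌋)

allVecs : {A : Set} → List A → (n : ℕ) → List (Vec A n)
allVecs xs zero = V.[] ∷ []
allVecs xs (suc n) = concatMap (λ x → L.map (x V.∷_) (allVecs xs n)) xs

countᵇ : {A : Set} → (A → Bool) → List A → ℕ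
countᵇ p xs = length (filterᵇ p xs)

Spin : Set
Spin = Bool

spinℤ : Spin → ℤ
spinℤ true  = + 1
spinℤ false = -[1+ 0 ]

segments : {A : Set} → List A → List (List A)
segments [] = []
segments (x ∷ xs) = L.map (x ∷_) (inits xs) ++ segments xs

sumOK : List Spin → Bool
sumOK l = ⌊ -[1+ 2 ] ℤ.≤? s ⌋ ∧ ⌊ s ℤ.≤? + 3 ⌋
  where s = L.foldr ℤ._+_ (+ 0) (L.map spinℤ l)

lineOK : List Spin → Bool
lineOK l = all sumOK (segments l)

-- spin configuration on [1,N]^2: row i (north to south), entry j (west to east)
SpinConfig : ℕ → Set
SpinConfig n = Vec (Vec Spin n) n

isCharge3 : {n : ℕ} → SpinConfig n → Bool
isCharge3 σ = all lineOK (L.map toList (toList σ))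
            ∧ all lineOK (L.map toList (toList (transpose σ)))

Zch : ℕ → ℕ
Zch n = countᵇ isCharge3 (allVecs (allVecs (true ∷ false ∷ []) n) n)

-- H i k : horizontal bond in row i, k = 0..N (bond k is west of vertex k,
--          east of vertex k-1; bonds 0 and N are dangling).
-- V k j : vertical bond in column j, k = 0..N (bond k is north of vertex
--          in row k, south of the vertex in row k-1).

HBonds VBonds : ℕ → Set
HBonds n = Vec (Vec (Fin 4) (suc n)) n
VBonds n = Vec (Vec (Fin 4) n) (suc n)

st : Fin 4 → ℤ
st x = + toℕ x

-- local rule at a vertex with north a, west b, east c, south d:
-- d - a = c - b ∈ {+1,-1}
vertexOK : Fin 4 → Fin 4 → Fin 4 → Fin 4 → Bool
vertexOK a b c d =
  ⌊ (st d ℤ.- st a) ℤ.≟ (st c ℤ.- st b) ⌋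
  ∧ (⌊ (st d ℤ.- st a) ℤ.≟ + 1 ⌋ Data.Bool.∨ ⌊ (st d ℤ.- st a) ℤ.≟ -[1+ 0 ] ⌋)
  where import Data.Bool

isQCharge : {n : ℕ} → HBonds n × VBonds n → Bool
isQCharge {n} (H , Vb) =
  all (λ i → all (λ j →
        vertexOK (lookup (lookup Vb (inject₁ i)) j)
                 (lookup (lookup H i) (inject₁ j))
                 (lookup (lookup H i) (fsuc j))
                 (lookup (lookup Vb (fsuc i)) j))
      (allFin n)) (allFin n)

ZQ : ℕ → ℕ
ZQ n = countᵇ isQCharge
  (cartesianProduct (allVecs (allVecs (allFin 4) (suc n)) n)
                    (allVecs (allVecs (allFin 4) n) (suc n)))

Eventually : (ℕ → Set) → Set
Eventually P = ∃ λ M → ∀ N → M ≤ N → P N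

-- "lim Z_N^{1/N^2} ≤ a/b" is witnessed by: eventually Z_N * b^{N²} ≤ a^{N²}
EventuallyBelow : (ℕ → ℕ) → ℕ → ℕ → Set
EventuallyBelow Z a b = Eventually (λ N → Z N N.* b ^ (N N.* N) ≤ a ^ (N N.* N))

EventuallyAbove : (ℕ → ℕ) → ℕ → ℕ → Set
EventuallyAbove Z c d = Eventually (λ N → c ^ (N N.* N) ≤ Z N N.* d ^ (N N.* N))

{-# OPTIONS --safe #-}
-- Reading each spin as the common increment of the bond states across its vertex, from west to
-- east and from north to south, a Q-charge configuration is the same thing as a charge(3)
-- configuration together with the initial state of every row and every column. Every charge(3)
-- configuration arises in this way: the prefix sums of a charge(3) line spread over an interval
-- of length at most 3, so minus the minimal prefix sum is an admissible initial value. Hence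
-- Zch N ≤ ZQ N ≤ 16^N · Zch N, and the factor 16^N is invisible at the scale N² of the exponent:
-- by Bernoulli's inequality (1 + 1/x)^N ≥ 1 + N/x, so 16^N x^(N²) < (x + 1)^(N²) once N ≥ 16 x.
module Submission where

open import Defs

module Enumeration where

  open import Data.Bool using (Bool; T)
  open import Data.Nat using (ℕ; zero; suc; _+_; _≤_; _*_; _^_; z≤n; s≤s)
  open import Data.Nat.Properties using (+-suc; module ≤-Reasoning)
  open import Data.List using (List; []; _∷_; _++_; map; concatMap; length; cartesianProductWith)
  open import Data.List.Properties using (length-++; length-map)
  open import Data.List.Membership.Propositional using (_∈_)
  open import Data.List.Membership.Propositional.Properties
    using (∈-∃++; ∈-++⁻; ∈-++⁺ˡ; ∈-++⁺ʳ; ∈-filter⁻; ∈-cartesianProductWith⁺)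
  open import Data.List.Relation.Unary.Any using (here; there)
  open import Data.List.Relation.Unary.All as All using ([])
  open import Data.List.Relation.Unary.AllPairs using ([]; _∷_)
  open import Data.List.Relation.Unary.Unique.Propositional using (Unique)
  import Data.List.Relation.Unary.Unique.Propositional.Properties as Unique
  open import Data.Vec as Vec using (Vec)
  open import Data.Vec.Properties using (∷-injective)
  open import Data.Product using (_,_)
  open import Data.Sum using (inj₁; inj₂)
  open import Function using (_∘_)
  open import Relation.Binary.PropositionalEquality
  open import Relation.Nullary using (contradiction)
  open import Relation.Nullary.Decidable using (T?)

  private variable A B : Set

  length-≤-retraction : (f : A → B) (g : B → A) {xs : List A} {ys : List B} → Unique xs →
    (∀ {x} → x ∈ xs → f x ∈ ys) → (∀ {x} → x ∈ xs → g (f x) ≡ x) → length xs ≤ length ys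
  length-≤-retraction f g {[]} _ _ _ = z≤n
  length-≤-retraction f g {x ∷ xs} (x∉xs ∷ unique) into retract
    with ys₁ , ys₂ , refl ← ∈-∃++ (into (here refl)) = begin
      suc (length xs)                 ≤⟨ s≤s (length-≤-retraction f g unique into′ (retract ∘ there)) ⟩
      suc (length (ys₁ ++ ys₂))       ≡⟨ cong suc (length-++ ys₁) ⟩
      suc (length ys₁ + length ys₂)   ≡⟨ +-suc (length ys₁) (length ys₂) ⟨
      length ys₁ + length (f x ∷ ys₂) ≡⟨ length-++ ys₁ ⟨
      length (ys₁ ++ f x ∷ ys₂)       ∎
    where
    open ≤-Reasoning
    into′ : ∀ {x′} → x′ ∈ xs → f x′ ∈ ys₁ ++ ys₂
    into′ {x′} x′∈xs with ∈-++⁻ ys₁ (into (there x′∈xs))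
    ... | inj₁ p         = ∈-++⁺ˡ p
    ... | inj₂ (there p) = ∈-++⁺ʳ ys₁ p
    ... | inj₂ (here fx′≡fx) =
      contradiction (trans (sym (retract (there x′∈xs))) (trans (cong g fx′≡fx) (retract (here refl))))
                    (All.lookup x∉xs x′∈xs ∘ sym)

  countᵇ-≤-retraction : (p : A → Bool) (f : A → B) (g : B → A) {xs : List A} {ys : List B} →
    Unique xs → (∀ {x} → x ∈ xs → T (p x) → f x ∈ ys) → (∀ {x} → x ∈ xs → T (p x) → g (f x) ≡ x) →
    countᵇ p xs ≤ length ys
  countᵇ-≤-retraction p f g unique into retract =
    length-≤-retraction f g (Unique.filter⁺ (T? ∘ p) unique)
      (λ x∈ → let x∈xs , px = ∈-filter⁻ (T? ∘ p) x∈ in into x∈xs px)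
      (λ x∈ → let x∈xs , px = ∈-filter⁻ (T? ∘ p) x∈ in retract x∈xs px)

  length-cartesianProductWith : {C : Set} (f : A → B → C) (xs : List A) (ys : List B) →
    length (cartesianProductWith f xs ys) ≡ length xs * length ys
  length-cartesianProductWith f [] ys = refl
  length-cartesianProductWith f (x ∷ xs) ys = begin
    length (map (f x) ys ++ cartesianProductWith f xs ys)
      ≡⟨ length-++ (map (f x) ys) ⟩
    length (map (f x) ys) + length (cartesianProductWith f xs ys)
      ≡⟨ cong₂ _+_ (length-map (f x) ys) (length-cartesianProductWith f xs ys) ⟩
    length ys + length xs * length ys ∎
    where open ≡-Reasoning

  concatMap-map≡cartesianProductWith : {C : Set} (f : A → B → C) (xs : List A) (ys : List B) →
    concatMap (λ x → map (f x) ys) xs ≡ cartesianProductWith f xs ys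
  concatMap-map≡cartesianProductWith f []       ys = refl
  concatMap-map≡cartesianProductWith f (x ∷ xs) ys =
    cong (map (f x) ys ++_) (concatMap-map≡cartesianProductWith f xs ys)

  allVecs-suc : (xs : List A) (n : ℕ) →
    allVecs xs (suc n) ≡ cartesianProductWith Vec._∷_ xs (allVecs xs n)
  allVecs-suc xs n = concatMap-map≡cartesianProductWith Vec._∷_ xs (allVecs xs n)

  allVecs-unique : {xs : List A} → Unique xs → ∀ n → Unique (allVecs xs n)
  allVecs-unique unique zero = [] ∷ []
  allVecs-unique {xs = xs} unique (suc n) rewrite allVecs-suc xs n =
    Unique.cartesianProductWith⁺ Vec._∷_ ∷-injective unique (allVecs-unique unique n)

  allVecs-complete : {xs : List A} → (∀ x → x ∈ xs) → ∀ {n} (v : Vec A n) → v ∈ allVecs xs n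
  allVecs-complete complete Vec.[] = here refl
  allVecs-complete {xs = xs} complete {suc n} (x Vec.∷ v) rewrite allVecs-suc xs n =
    ∈-cartesianProductWith⁺ Vec._∷_ (complete x) (allVecs-complete complete v)

  length-allVecs : (xs : List A) → ∀ n → length (allVecs xs n) ≡ length xs ^ n
  length-allVecs xs zero = refl
  length-allVecs xs (suc n) rewrite allVecs-suc xs n =
    trans (length-cartesianProductWith Vec._∷_ xs (allVecs xs n))
          (cong (length xs *_) (length-allVecs xs n))

module Matrix where

  open import Data.Bool using (Bool; T)
  open import Data.Bool.Properties using (T-∧)
  open import Data.Bool.ListAction using (all)
  open import Data.Fin using (Fin) renaming (zero to fzero; suc to fsuc)
  open import Data.List using (List; allFin)
  import Data.List as List
  open import Data.List.Membership.Propositional.Properties using (∈-allFin)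
  import Data.List.Relation.Unary.All as All
  open import Data.List.Relation.Unary.All.Properties using (all⁺; all⁻)
  open import Data.Vec using (Vec; []; _∷_; lookup; toList; transpose; replicate; _⊛_)
  open import Data.Vec.Properties using (lookup-⊛; lookup-replicate)
  open import Data.Vec.Relation.Binary.Pointwise.Extensional using (ext; Pointwise-≡⇒≡)
  open import Data.Product using (_,_; proj₁; proj₂)
  open import Function using (_∘_; Equivalence)
  open import Relation.Binary.PropositionalEquality

  all-allFin⁻ : ∀ {n} (p : Fin n → Bool) → T (all p (allFin n)) → ∀ i → T (p i)
  all-allFin⁻ p ok i = All.lookup (all⁺ p _ ok) (∈-allFin i)

  all-allFin⁺ : ∀ {n} (p : Fin n → Bool) → (∀ i → T (p i)) → T (all p (allFin n))
  all-allFin⁺ {n} p ok = all⁻ p {allFin n} (All.tabulate λ {i} _ → ok i)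

  all-map-toList⁻ : ∀ {A : Set} {k m} (p : List A → Bool) (M : Vec (Vec A k) m) →
    T (all p (List.map toList (toList M))) → ∀ i → T (p (toList (lookup M i)))
  all-map-toList⁻ p (r ∷ M) ok fzero    = proj₁ (Equivalence.to T-∧ ok)
  all-map-toList⁻ p (r ∷ M) ok (fsuc i) =
    all-map-toList⁻ p M (proj₂ (Equivalence.to (T-∧ {p (toList r)}) ok)) i

  all-map-toList⁺ : ∀ {A : Set} {k m} (p : List A → Bool) (M : Vec (Vec A k) m) →
    (∀ i → T (p (toList (lookup M i)))) → T (all p (List.map toList (toList M)))
  all-map-toList⁺ p []      _  = _
  all-map-toList⁺ p (r ∷ M) ok = Equivalence.from T-∧ (ok fzero , all-map-toList⁺ p M (ok ∘ fsuc))

  lookup-transpose : ∀ {A : Set} {m n} (M : Vec (Vec A n) m) j i →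
    lookup (lookup (transpose M) j) i ≡ lookup (lookup M i) j
  lookup-transpose {n = n} (r ∷ M) j i = begin
    lookup (lookup (replicate n _∷_ ⊛ r ⊛ transpose M) j) i
      ≡⟨ cong (λ c → lookup c i) (lookup-⊛ j (replicate n _∷_ ⊛ r) (transpose M)) ⟩
    lookup (lookup (replicate n _∷_ ⊛ r) j (lookup (transpose M) j)) i
      ≡⟨ cong (λ f → lookup (f (lookup (transpose M) j)) i)
              (trans (lookup-⊛ j (replicate n _∷_) r)
                     (cong (λ f → f (lookup r j)) (lookup-replicate j _∷_))) ⟩
    lookup (lookup r j ∷ lookup (transpose M) j) i
      ≡⟨ lookup-cons i ⟩
    lookup (lookup (r ∷ M) i) j ∎
    where
    open ≡-Reasoning
    lookup-cons : ∀ i → lookup (lookup r j ∷ lookup (transpose M) j) i ≡ lookup (lookup (r ∷ M) i) j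
    lookup-cons fzero    = refl
    lookup-cons (fsuc i) = lookup-transpose M j i

  transpose-involutive : ∀ {A : Set} {m n} (M : Vec (Vec A n) m) → transpose (transpose M) ≡ M
  transpose-involutive M = Pointwise-≡⇒≡ (ext λ i → Pointwise-≡⇒≡ (ext λ j →
    trans (lookup-transpose (transpose M) i j) (lookup-transpose M j i)))

module ChargeLines where

  open import Data.Bool using (T)
  open import Data.Bool.Properties using (T-∧)
  open import Data.Nat using (z≤n)
  open import Data.Integer using (ℤ; +_; -[1+_]; _+_; -_; _≤_; _≤?_; _⊓_; _⊔_; +≤+)
  open import Data.Integer.Properties
    using (≤-trans; ≤-reflexive; +-monoʳ-≤; +-monoˡ-≤; +-assoc; +-identityˡ; +-identityʳ; +-inverseˡ;
           ⊓-sel; ⊔-sel; ⊓-glb; ⊔-lub; i⊓j≤i; i⊓j≤j; i≤i⊔j; i≤j⊔i; mono-≤-distrib-⊓; module ≤-Reasoning)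
  open import Data.Integer.Tactic.RingSolver using (solve-∀)
  open import Data.List using (List; []; _∷_; map; foldr; inits)
  open import Data.List.Membership.Propositional using (_∈_)
  open import Data.List.Membership.Propositional.Properties using (∈-map⁺; ∈-map⁻)
  open import Data.List.Relation.Unary.Any using (here; there)
  import Data.List.Relation.Unary.All as All
  open import Data.List.Relation.Unary.All.Properties using (all⁺; all⁻; ++⁺; ++⁻; map⁺; map⁻)
  open import Data.Product using (_×_; _,_; proj₁; proj₂; ∃-syntax)
  open import Data.Sum using (inj₁; inj₂)
  open import Function using (Equivalence)
  open import Relation.Binary.PropositionalEquality
  open import Relation.Nullary.Decidable using (toWitness; fromWitness)

  _∈[0,3] _∈[-3,3] : ℤ → Set
  z ∈[0,3]  = + 0 ≤ z × z ≤ + 3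
  z ∈[-3,3] = -[1+ 2 ] ≤ z × z ≤ + 3

  spinSum : List Spin → ℤ
  spinSum l = foldr _+_ (+ 0) (map spinℤ l)

  sumOK⁻ : ∀ l → T (sumOK l) → spinSum l ∈[-3,3]
  sumOK⁻ l ok = let lo , hi = Equivalence.to T-∧ ok in
    toWitness {a? = -[1+ 2 ] ≤? spinSum l} lo , toWitness {a? = spinSum l ≤? + 3} hi

  sumOK⁺ : ∀ l → spinSum l ∈[-3,3] → T (sumOK l)
  sumOK⁺ l (lo , hi) = Equivalence.from T-∧
    (fromWitness {a? = -[1+ 2 ] ≤? spinSum l} lo , fromWitness {a? = spinSum l ≤? + 3} hi)

  lineOK-∷⁻ : ∀ x l → T (lineOK (x ∷ l)) →
    (∀ {p} → p ∈ inits l → spinSum (x ∷ p) ∈[-3,3]) × T (lineOK l)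
  lineOK-∷⁻ x l ok = let first , rest = ++⁻ (map (x ∷_) (inits l)) (all⁺ sumOK _ ok) in
    (λ {p} p∈ → sumOK⁻ (x ∷ p) (All.lookup (map⁻ first) p∈)) , all⁻ sumOK rest

  lineOK-∷⁺ : ∀ x l → (∀ {p} → p ∈ inits l → spinSum (x ∷ p) ∈[-3,3]) → T (lineOK l) →
    T (lineOK (x ∷ l))
  lineOK-∷⁺ x l first rest =
    all⁻ sumOK (++⁺ (map⁺ (All.tabulate λ {p} p∈ → sumOK⁺ (x ∷ p) (first p∈))) (all⁺ sumOK _ rest))

  BandWalk : ℤ → List Spin → Set
  BandWalk s []      = s ∈[0,3]
  BandWalk s (x ∷ l) = s ∈[0,3] × BandWalk (s + spinℤ x) l

  bandWalk-head : ∀ s l → BandWalk s l → s ∈[0,3]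
  bandWalk-head s []      walk     = walk
  bandWalk-head s (x ∷ l) (s∈ , _) = s∈

  bandWalk-prefix : ∀ s l → BandWalk s l → ∀ {p} → p ∈ inits l → (s + spinSum p) ∈[0,3]
  bandWalk-prefix s l walk (here refl) = subst _∈[0,3] (sym (+-identityʳ s)) (bandWalk-head s l walk)
  bandWalk-prefix s (x ∷ l) (_ , walk) (there p∈) with p , p∈ , refl ← ∈-map⁻ (x ∷_) p∈ =
    subst _∈[0,3] (+-assoc s (spinℤ x) (spinSum p)) (bandWalk-prefix (s + spinℤ x) l walk p∈)

  ∈[0,3]-difference : ∀ a z → a ∈[0,3] → (a + z) ∈[0,3] → z ∈[-3,3]
  ∈[0,3]-difference a z (0≤a , a≤3) (0≤a+z , a+z≤3) = lo , hi
    where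
    open ≤-Reasoning
    lo : -[1+ 2 ] ≤ z
    lo = begin
      -[1+ 2 ]              ≤⟨ +-monoʳ-≤ -[1+ 2 ] (≤-trans 0≤a+z (+-monoˡ-≤ z a≤3)) ⟩
      -[1+ 2 ] + (+ 3 + z)  ≡⟨ cancel z ⟩
      z                     ∎
      where
      cancel : ∀ z → -[1+ 2 ] + (+ 3 + z) ≡ z
      cancel = solve-∀
    hi : z ≤ + 3
    hi = begin
      z       ≡⟨ +-identityˡ z ⟨
      + 0 + z ≤⟨ +-monoˡ-≤ z 0≤a ⟩
      a + z   ≤⟨ a+z≤3 ⟩
      + 3     ∎

  bandWalk⇒lineOK : ∀ s l → BandWalk s l → T (lineOK l)
  bandWalk⇒lineOK s []      _           = _
  bandWalk⇒lineOK s (x ∷ l) (s∈ , walk) = lineOK-∷⁺ x l first (bandWalk⇒lineOK (s + spinℤ x) l walk)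
    where
    first : ∀ {p} → p ∈ inits l → spinSum (x ∷ p) ∈[-3,3]
    first {p} p∈ = ∈[0,3]-difference s (spinSum (x ∷ p)) s∈
      (subst _∈[0,3] (+-assoc s (spinℤ x) (spinSum p)) (bandWalk-prefix (s + spinℤ x) l walk p∈))

  minPrefixSum maxPrefixSum : List Spin → ℤ
  minPrefixSum []      = + 0
  minPrefixSum (x ∷ l) = + 0 ⊓ (spinℤ x + minPrefixSum l)
  maxPrefixSum []      = + 0
  maxPrefixSum (x ∷ l) = + 0 ⊔ (spinℤ x + maxPrefixSum l)

  minPrefixSum-attained : ∀ l → ∃[ p ] p ∈ inits l × spinSum p ≡ minPrefixSum l
  minPrefixSum-attained []      = [] , here refl , refl
  minPrefixSum-attained (x ∷ l) with ⊓-sel (+ 0) (spinℤ x + minPrefixSum l)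
  ... | inj₁ min≡0 = [] , here refl , sym min≡0
  ... | inj₂ min≡  = let p , p∈ , sum≡ = minPrefixSum-attained l in
    x ∷ p , there (∈-map⁺ (x ∷_) p∈) , trans (cong (λ s → spinℤ x + s) sum≡) (sym min≡)

  maxPrefixSum-attained : ∀ l → ∃[ p ] p ∈ inits l × spinSum p ≡ maxPrefixSum l
  maxPrefixSum-attained []      = [] , here refl , refl
  maxPrefixSum-attained (x ∷ l) with ⊔-sel (+ 0) (spinℤ x + maxPrefixSum l)
  ... | inj₁ max≡0 = [] , here refl , sym max≡0
  ... | inj₂ max≡  = let p , p∈ , sum≡ = maxPrefixSum-attained l in
    x ∷ p , there (∈-map⁺ (x ∷_) p∈) , trans (cong (λ s → spinℤ x + s) sum≡) (sym max≡)

  prefixSum-spread : ∀ l → T (lineOK l) → maxPrefixSum l ≤ + 3 + minPrefixSum l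
  prefixSum-spread []      _  = +≤+ z≤n
  prefixSum-spread (x ∷ l) ok =
    ⊔-lub (subst (+ 0 ≤_) (sym distrib) (⊓-glb (+≤+ z≤n) 0≤3+x+min))
          (subst (spinℤ x + maxPrefixSum l ≤_) (sym distrib) (⊓-glb x+max≤3 x+max≤3+x+min))
    where
    first : ∀ {p} → p ∈ inits l → spinSum (x ∷ p) ∈[-3,3]
    first = proj₁ (lineOK-∷⁻ x l ok)
    rest : T (lineOK l)
    rest = proj₂ (lineOK-∷⁻ x l ok)
    distrib : + 3 + (+ 0 ⊓ (spinℤ x + minPrefixSum l)) ≡ + 3 ⊓ (+ 3 + (spinℤ x + minPrefixSum l))
    distrib = mono-≤-distrib-⊓ (+-monoʳ-≤ (+ 3)) (+ 0) (spinℤ x + minPrefixSum l)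
    0≤3+x+min : + 0 ≤ + 3 + (spinℤ x + minPrefixSum l)
    0≤3+x+min with p , p∈ , sum≡ ← minPrefixSum-attained l =
      +-monoʳ-≤ (+ 3) (subst (λ m → -[1+ 2 ] ≤ spinℤ x + m) sum≡ (proj₁ (first p∈)))
    x+max≤3 : spinℤ x + maxPrefixSum l ≤ + 3
    x+max≤3 with p , p∈ , sum≡ ← maxPrefixSum-attained l =
      subst (λ m → spinℤ x + m ≤ + 3) sum≡ (proj₂ (first p∈))
    x+max≤3+x+min : spinℤ x + maxPrefixSum l ≤ + 3 + (spinℤ x + minPrefixSum l)
    x+max≤3+x+min = ≤-trans (+-monoʳ-≤ (spinℤ x) (prefixSum-spread l rest))
                            (≤-reflexive (swap (spinℤ x) (+ 3) (minPrefixSum l)))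
      where
      swap : ∀ a b c → a + (b + c) ≡ b + (a + c)
      swap = solve-∀

  bandWalk-within : ∀ s l → + 0 ≤ s + minPrefixSum l → s + maxPrefixSum l ≤ + 3 → BandWalk s l
  bandWalk-within s []      lo hi = subst _∈[0,3] (+-identityʳ s) (lo , hi)
  bandWalk-within s (x ∷ l) lo hi = (0≤s , s≤3) , bandWalk-within (s + spinℤ x) l lo′ hi′
    where
    t u : ℤ
    t = spinℤ x + minPrefixSum l
    u = spinℤ x + maxPrefixSum l
    0≤s : + 0 ≤ s
    0≤s = ≤-trans lo (subst (s + (+ 0 ⊓ t) ≤_) (+-identityʳ s) (+-monoʳ-≤ s (i⊓j≤i (+ 0) t)))
    s≤3 : s ≤ + 3
    s≤3 = ≤-trans (subst (_≤ s + (+ 0 ⊔ u)) (+-identityʳ s) (+-monoʳ-≤ s (i≤i⊔j (+ 0) u))) hi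
    lo′ : + 0 ≤ s + spinℤ x + minPrefixSum l
    lo′ = subst (+ 0 ≤_) (sym (+-assoc s (spinℤ x) (minPrefixSum l))) (≤-trans lo (+-monoʳ-≤ s (i⊓j≤j (+ 0) t)))
    hi′ : s + spinℤ x + maxPrefixSum l ≤ + 3
    hi′ = subst (_≤ + 3) (sym (+-assoc s (spinℤ x) (maxPrefixSum l))) (≤-trans (+-monoʳ-≤ s (i≤j⊔i (+ 0) u)) hi)

  lineOK⇒bandWalk : ∀ l → T (lineOK l) → BandWalk (- minPrefixSum l) l
  lineOK⇒bandWalk l ok = bandWalk-within (- minPrefixSum l) l
    (≤-reflexive (sym (+-inverseˡ (minPrefixSum l))))
    (≤-trans (+-monoʳ-≤ (- minPrefixSum l) (prefixSum-spread l ok))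
             (≤-reflexive (cancel (minPrefixSum l))))
    where
    cancel : ∀ m → - m + (+ 3 + m) ≡ + 3
    cancel = solve-∀

module BondStates where

  open ChargeLines
  open import Data.Bool using (true; false; T; _∧_; _∨_)
  open import Data.Nat using (suc; z≤n; s≤s)
  open import Data.Integer using (ℤ; +_; -[1+_]; _+_; -_; _-_; _≟_; +≤+)
  open import Data.Integer.Tactic.RingSolver using (solve-∀)
  open import Data.Fin using (Fin; inject₁) renaming (zero to fzero; suc to fsuc)
  open import Data.Vec using (Vec; []; _∷_; head; lookup; toList; tabulate)
  open import Data.Product using (_×_; _,_; ∃-syntax)
  open import Function using (_∘_)
  open import Relation.Binary.PropositionalEquality
  open import Relation.Nullary using (yes; no; contradiction)
  open import Relation.Nullary.Decidable using (⌊_⌋)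

  clamp : ℤ → Fin 4
  clamp (+ 0)                 = fzero
  clamp (+ 1)                 = fsuc fzero
  clamp (+ 2)                 = fsuc (fsuc fzero)
  clamp (+ suc (suc (suc _))) = fsuc (fsuc (fsuc fzero))
  clamp -[1+ _ ]              = fzero

  st-clamp : ∀ z → z ∈[0,3] → st (clamp z) ≡ z
  st-clamp (+ 0) _ = refl
  st-clamp (+ 1) _ = refl
  st-clamp (+ 2) _ = refl
  st-clamp (+ 3) _ = refl
  st-clamp (+ suc (suc (suc (suc _)))) (_ , +≤+ (s≤s (s≤s (s≤s ()))))
  st-clamp -[1+ _ ] (() , _)

  clamp-st : ∀ b → clamp (st b) ≡ b
  clamp-st fzero                      = refl
  clamp-st (fsuc fzero)               = refl
  clamp-st (fsuc (fsuc fzero))        = refl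
  clamp-st (fsuc (fsuc (fsuc fzero))) = refl

  st-∈[0,3] : ∀ b → st b ∈[0,3]
  st-∈[0,3] fzero                      = +≤+ z≤n , +≤+ z≤n
  st-∈[0,3] (fsuc fzero)               = +≤+ z≤n , +≤+ (s≤s z≤n)
  st-∈[0,3] (fsuc (fsuc fzero))        = +≤+ z≤n , +≤+ (s≤s (s≤s z≤n))
  st-∈[0,3] (fsuc (fsuc (fsuc fzero))) = +≤+ z≤n , +≤+ (s≤s (s≤s (s≤s z≤n)))

  record Step (a : Fin 4) (x : Spin) (d : Fin 4) : Set where
    constructor step
    field increment : st d ≡ st a + spinℤ x
  open Step

  Step-cong : ∀ {a a′ x x′ d d′} → a ≡ a′ → x ≡ x′ → d ≡ d′ → Step a x d → Step a′ x′ d′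
  Step-cong refl refl refl a→d = a→d

  i-j≡k⇒i≡j+k : ∀ m n k → m - n ≡ k → m ≡ n + k
  i-j≡k⇒i≡j+k m n k m-n≡k = trans (sym (lemma m n)) (cong (λ z → n + z) m-n≡k)
    where
    lemma : ∀ m n → n + (m - n) ≡ m
    lemma = solve-∀

  i≡j+k⇒i-j≡k : ∀ m n k → m ≡ n + k → m - n ≡ k
  i≡j+k⇒i-j≡k m n k m≡n+k = trans (cong (_- n) m≡n+k) (lemma n k)
    where
    lemma : ∀ n k → n + k - n ≡ k
    lemma = solve-∀

  isUnitStep⁻ : ∀ u v → T (⌊ u ≟ v ⌋ ∧ (⌊ u ≟ + 1 ⌋ ∨ ⌊ u ≟ -[1+ 0 ] ⌋)) →
    ∃[ x ] u ≡ spinℤ x × v ≡ spinℤ x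
  isUnitStep⁻ u v ok with u ≟ v | u ≟ + 1 | u ≟ -[1+ 0 ]
  ... | yes refl | yes u≡1  | _         = true  , u≡1 , u≡1
  ... | yes refl | no _     | yes u≡-1  = false , u≡-1 , u≡-1

  isUnitStep⁺ : ∀ x → T (⌊ spinℤ x ≟ spinℤ x ⌋ ∧ (⌊ spinℤ x ≟ + 1 ⌋ ∨ ⌊ spinℤ x ≟ -[1+ 0 ] ⌋))
  isUnitStep⁺ true  = _
  isUnitStep⁺ false = _

  vertexOK⁻ : ∀ a b c d → T (vertexOK a b c d) → ∃[ x ] Step a x d × Step b x c
  vertexOK⁻ a b c d ok =
    let x , d-a≡x , c-b≡x = isUnitStep⁻ (st d - st a) (st c - st b) ok
    in x , step (i-j≡k⇒i≡j+k (st d) (st a) (spinℤ x) d-a≡x)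
         , step (i-j≡k⇒i≡j+k (st c) (st b) (spinℤ x) c-b≡x)

  vertexOK⁺ : ∀ a b c d x → Step a x d → Step b x c → T (vertexOK a b c d)
  vertexOK⁺ a b c d x (step a→d) (step b→c)
    rewrite i≡j+k⇒i-j≡k (st d) (st a) (spinℤ x) a→d | i≡j+k⇒i-j≡k (st c) (st b) (spinℤ x) b→c =
    isUnitStep⁺ x

  spinOfStep : Fin 4 → Fin 4 → Spin
  spinOfStep b c = ⌊ st c ≟ st b + + 1 ⌋

  spinOfStep-correct : ∀ b x c → Step b x c → spinOfStep b c ≡ x
  spinOfStep-correct b x c (step b→c) with st c ≟ st b + + 1
  spinOfStep-correct b true  c (step b→c) | yes _     = refl
  spinOfStep-correct b true  c (step b→c) | no c≢b+1  = contradiction b→c c≢b+1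
  spinOfStep-correct b false c (step b→c) | no _      = refl
  spinOfStep-correct b false c (step b→c) | yes c≡b+1
    with () ← trans (sym (i≡j+k⇒i-j≡k (st c) (st b) -[1+ 0 ] b→c)) (i≡j+k⇒i-j≡k (st c) (st b) (+ 1) c≡b+1)

  bondWalk : ∀ {m} → Fin 4 → Vec Spin m → Vec (Fin 4) (suc m)
  bondWalk b []       = b ∷ []
  bondWalk b (x ∷ xs) = b ∷ bondWalk (clamp (st b + spinℤ x)) xs

  lookup-bondWalk-zero : ∀ {m} b (xs : Vec Spin m) → lookup (bondWalk b xs) fzero ≡ b
  lookup-bondWalk-zero b []      = refl
  lookup-bondWalk-zero b (_ ∷ _) = refl

  StepsBy : ∀ {m} → Vec (Fin 4) (suc m) → Vec Spin m → Set
  StepsBy w xs = ∀ j → Step (lookup w (inject₁ j)) (lookup xs j) (lookup w (fsuc j))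

  bondWalk-stepsBy : ∀ {m} b (xs : Vec Spin m) → BandWalk (st b) (toList xs) →
    StepsBy (bondWalk b xs) xs
  bondWalk-stepsBy b (x ∷ xs) (_ , walk) fzero =
    step (trans (cong st (lookup-bondWalk-zero _ xs)) next≡)
    where next≡ = st-clamp _ (bandWalk-head _ (toList xs) walk)
  bondWalk-stepsBy b (x ∷ xs) (_ , walk) (fsuc j) =
    bondWalk-stepsBy _ xs (subst (λ s → BandWalk s (toList xs)) (sym next≡) walk) j
    where next≡ = st-clamp _ (bandWalk-head _ (toList xs) walk)

  stepsBy⇒bandWalk : ∀ {m} (w : Vec (Fin 4) (suc m)) xs → StepsBy w xs →
    BandWalk (st (head w)) (toList xs)
  stepsBy⇒bandWalk (b ∷ [])    []       _     = st-∈[0,3] b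
  stepsBy⇒bandWalk (b ∷ c ∷ w) (x ∷ xs) steps = st-∈[0,3] b ,
    subst (λ s → BandWalk s (toList xs)) (increment (steps fzero))
          (stepsBy⇒bandWalk (c ∷ w) xs (steps ∘ fsuc))

  stepsBy⇒bondWalk : ∀ {m} (w : Vec (Fin 4) (suc m)) xs → StepsBy w xs → bondWalk (head w) xs ≡ w
  stepsBy⇒bondWalk (b ∷ [])    []       _     = refl
  stepsBy⇒bondWalk (b ∷ c ∷ w) (x ∷ xs) steps = cong (b ∷_) (begin
    bondWalk (clamp (st b + spinℤ x)) xs ≡⟨ cong (λ c′ → bondWalk c′ xs) next≡c ⟩
    bondWalk c xs                        ≡⟨ stepsBy⇒bondWalk (c ∷ w) xs (steps ∘ fsuc) ⟩
    c ∷ w                                ∎)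
    where
    open ≡-Reasoning
    next≡c : clamp (st b + spinℤ x) ≡ c
    next≡c = trans (cong clamp (sym (increment (steps fzero)))) (clamp-st c)

  spinsOf : ∀ {m} → Vec (Fin 4) (suc m) → Vec Spin m
  spinsOf w = tabulate λ j → spinOfStep (lookup w (inject₁ j)) (lookup w (fsuc j))

  lineStart : ∀ {m} → Vec Spin m → Fin 4
  lineStart xs = clamp (- minPrefixSum (toList xs))

  lineStart-bandWalk : ∀ {m} (xs : Vec Spin m) → T (lineOK (toList xs)) →
    BandWalk (st (lineStart xs)) (toList xs)
  lineStart-bandWalk xs ok =
    subst (λ s → BandWalk s (toList xs)) (sym (st-clamp _ (bandWalk-head _ _ walk))) walk
    where walk = lineOK⇒bandWalk (toList xs) ok

module Realization where

  open ChargeLines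
  open Matrix
  open BondStates
  open import Data.Bool using (T)
  open import Data.Nat using (suc)
  open import Data.Bool.Properties using (T-∧)
  open import Data.Bool.ListAction using (all)
  open import Data.Fin using (Fin; inject₁) renaming (zero to fzero; suc to fsuc)
  import Data.List as List
  open import Data.Vec using (Vec; []; _∷_; head; lookup; toList; map; zipWith; transpose)
  open import Data.Vec.Properties using (lookup-map; lookup-zipWith; lookup∘tabulate)
  open import Data.Vec.Relation.Binary.Pointwise.Extensional using (ext; Pointwise-≡⇒≡)
  open import Data.Product using (_×_; _,_; proj₁; proj₂)
  open import Function using (_∘_; Equivalence)
  open import Relation.Binary.PropositionalEquality

  Realizes : ∀ {n} → SpinConfig n → HBonds n × VBonds n → Set
  Realizes {n} σ (H , Vb) = ∀ (i j : Fin n) →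
      Step (lookup (lookup H i) (inject₁ j)) (lookup (lookup σ i) j) (lookup (lookup H i) (fsuc j))
    × Step (lookup (lookup Vb (inject₁ i)) j) (lookup (lookup σ i) j) (lookup (lookup Vb (fsuc i)) j)

  spinConfigOf : ∀ {n} → HBonds n × VBonds n → SpinConfig n
  spinConfigOf (H , _) = map spinsOf H

  lookup-spinConfigOf : ∀ {n} (H : HBonds n) (Vb : VBonds n) i j → lookup (lookup (spinConfigOf (H , Vb)) i) j
    ≡ spinOfStep (lookup (lookup H i) (inject₁ j)) (lookup (lookup H i) (fsuc j))
  lookup-spinConfigOf H _ i j =
    trans (cong (λ r → lookup r j) (lookup-map i spinsOf H)) (lookup∘tabulate _ j)

  isQCharge⇒realizes : ∀ {n} (Q : HBonds n × VBonds n) → T (isQCharge Q) →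
    Realizes (spinConfigOf Q) Q
  isQCharge⇒realizes (H , Vb) ok i j =
    let x , a→d , b→c = vertexOK⁻ _ _ _ _ (all-allFin⁻ _ (all-allFin⁻ _ ok i) j)
        σij≡x = trans (lookup-spinConfigOf H Vb i j) (spinOfStep-correct _ _ _ b→c)
    in Step-cong refl (sym σij≡x) refl b→c , Step-cong refl (sym σij≡x) refl a→d

  realizes⇒isQCharge : ∀ {n} (σ : SpinConfig n) Q → Realizes σ Q → T (isQCharge Q)
  realizes⇒isQCharge σ Q realizes = all-allFin⁺ _ λ i → all-allFin⁺ _ λ j →
    vertexOK⁺ _ _ _ _ _ (proj₂ (realizes i j)) (proj₁ (realizes i j))

  realizes⇒spinConfigOf : ∀ {n} (σ : SpinConfig n) Q → Realizes σ Q → spinConfigOf Q ≡ σ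
  realizes⇒spinConfigOf σ (H , Vb) realizes = Pointwise-≡⇒≡ (ext λ i → Pointwise-≡⇒≡ (ext λ j →
    trans (lookup-spinConfigOf H Vb i j) (spinOfStep-correct _ _ _ (proj₁ (realizes i j)))))

  realizes⇒rows : ∀ {n} (σ : SpinConfig n) H Vb → Realizes σ (H , Vb) →
    ∀ i → StepsBy (lookup H i) (lookup σ i)
  realizes⇒rows σ H Vb realizes i j = proj₁ (realizes i j)

  realizes⇒columns : ∀ {n} (σ : SpinConfig n) H Vb → Realizes σ (H , Vb) →
    ∀ j → StepsBy (lookup (transpose Vb) j) (lookup (transpose σ) j)
  realizes⇒columns σ H Vb realizes j i = Step-cong
    (sym (lookup-transpose Vb j (inject₁ i))) (sym (lookup-transpose σ j i))
    (sym (lookup-transpose Vb j (fsuc i))) (proj₂ (realizes i j))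

  rows∧columns⇒realizes : ∀ {n} (σ : SpinConfig n) H Vb →
    (∀ i → StepsBy (lookup H i) (lookup σ i)) →
    (∀ j → StepsBy (lookup (transpose Vb) j) (lookup (transpose σ) j)) → Realizes σ (H , Vb)
  rows∧columns⇒realizes σ H Vb rows columns i j = rows i j , Step-cong
    (lookup-transpose Vb j (inject₁ i)) (lookup-transpose σ j i) (lookup-transpose Vb j (fsuc i))
    (columns j i)

  realizes⇒isCharge3 : ∀ {n} (σ : SpinConfig n) Q → Realizes σ Q → T (isCharge3 σ)
  realizes⇒isCharge3 σ (H , Vb) realizes = Equivalence.from T-∧
    ( all-map-toList⁺ lineOK σ (λ i →
        bandWalk⇒lineOK _ (toList (lookup σ i))
          (stepsBy⇒bandWalk (lookup H i) _ (realizes⇒rows σ H Vb realizes i)))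
    , all-map-toList⁺ lineOK (transpose σ) (λ j →
        bandWalk⇒lineOK _ (toList (lookup (transpose σ) j))
          (stepsBy⇒bandWalk (lookup (transpose Vb) j) _ (realizes⇒columns σ H Vb realizes j))))

  bondConfig : ∀ {n} → SpinConfig n → Vec (Fin 4) n → Vec (Fin 4) n → HBonds n × VBonds n
  bondConfig σ r c = zipWith bondWalk r σ , transpose (zipWith bondWalk c (transpose σ))

  zipWith-bondWalk-stepsBy : ∀ {m n} (starts : Vec (Fin 4) n) (τ : Vec (Vec Spin m) n) →
    (∀ i → BandWalk (st (lookup starts i)) (toList (lookup τ i))) →
    ∀ i → StepsBy (lookup (zipWith bondWalk starts τ) i) (lookup τ i)
  zipWith-bondWalk-stepsBy starts τ bands i rewrite lookup-zipWith bondWalk i starts τ =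
    bondWalk-stepsBy (lookup starts i) (lookup τ i) (bands i)

  bondConfig-realizes : ∀ {n} (σ : SpinConfig n) r c →
    (∀ i → BandWalk (st (lookup r i)) (toList (lookup σ i))) →
    (∀ j → BandWalk (st (lookup c j)) (toList (lookup (transpose σ) j))) →
    Realizes σ (bondConfig σ r c)
  bondConfig-realizes σ r c rowBands columnBands =
    rows∧columns⇒realizes σ (zipWith bondWalk r σ) (transpose (zipWith bondWalk c (transpose σ)))
      (zipWith-bondWalk-stepsBy r σ rowBands) columns
    where
    columns : ∀ j → StepsBy (lookup (transpose (transpose (zipWith bondWalk c (transpose σ)))) j)
                            (lookup (transpose σ) j)
    columns rewrite transpose-involutive (zipWith bondWalk c (transpose σ)) =
      zipWith-bondWalk-stepsBy c (transpose σ) columnBands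

  zipWith-bondWalk-heads : ∀ {m n} (M : Vec (Vec (Fin 4) (suc m)) n) (τ : Vec (Vec Spin m) n) →
    (∀ i → StepsBy (lookup M i) (lookup τ i)) → zipWith bondWalk (map head M) τ ≡ M
  zipWith-bondWalk-heads []      []      _     = refl
  zipWith-bondWalk-heads (w ∷ M) (xs ∷ τ) steps =
    cong₂ _∷_ (stepsBy⇒bondWalk w xs (steps fzero)) (zipWith-bondWalk-heads M τ (steps ∘ fsuc))

  rowStarts columnStarts : ∀ {n} → HBonds n × VBonds n → Vec (Fin 4) n
  rowStarts    (H , _)  = map head H
  columnStarts (_ , Vb) = map head (transpose Vb)

  realizes⇒bondConfig : ∀ {n} (σ : SpinConfig n) Q → Realizes σ Q →
    bondConfig σ (rowStarts Q) (columnStarts Q) ≡ Q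
  realizes⇒bondConfig σ (H , Vb) realizes = cong₂ _,_
    (zipWith-bondWalk-heads H σ (realizes⇒rows σ H Vb realizes))
    (trans (cong transpose (zipWith-bondWalk-heads (transpose Vb) (transpose σ)
                                                   (realizes⇒columns σ H Vb realizes)))
           (transpose-involutive Vb))

  canonicalBonds : ∀ {n} → SpinConfig n → HBonds n × VBonds n
  canonicalBonds σ = bondConfig σ (map lineStart σ) (map lineStart (transpose σ))

  isCharge3⇒realizes : ∀ {n} (σ : SpinConfig n) → T (isCharge3 σ) → Realizes σ (canonicalBonds σ)
  isCharge3⇒realizes σ ok = bondConfig-realizes σ (map lineStart σ) (map lineStart (transpose σ))
    (bands σ (proj₁ (Equivalence.to T-∧ ok)))
    (bands (transpose σ) (proj₂ (Equivalence.to (T-∧ {all lineOK (List.map toList (toList σ))}) ok)))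
    where
    bands : ∀ {n} (τ : Vec (Vec Spin n) n) → T (all lineOK (List.map toList (toList τ))) →
      ∀ i → BandWalk (st (lookup (map lineStart τ) i)) (toList (lookup τ i))
    bands τ linesOK i rewrite lookup-map i lineStart τ =
      lineStart-bandWalk (lookup τ i) (all-map-toList⁻ lineOK τ linesOK i)

module GrowthRates where

  open import Data.Nat
  open import Data.Nat.Properties
  open import Data.Nat.Tactic.RingSolver using (solve-∀)
  open import Data.Product using (_×_; _,_)
  open import Relation.Nullary using (¬_)
  open import Relation.Binary.PropositionalEquality

  ^-distribʳ-* : ∀ m n o → (m * n) ^ o ≡ m ^ o * n ^ o
  ^-distribʳ-* m n zero    = refl
  ^-distribʳ-* m n (suc o) =
    trans (cong (m * n *_) (^-distribʳ-* m n o)) (interchange m n (m ^ o) (n ^ o))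
    where
    interchange : ∀ a b c d → a * b * (c * d) ≡ a * c * (b * d)
    interchange = solve-∀

  bernoulli : ∀ x N → (x + N) * x ^ N ≤ x * suc x ^ N
  bernoulli x zero    = ≤-reflexive (cong (_* 1) (+-identityʳ x))
  bernoulli x (suc N) = begin
    (x + suc N) * (x * x ^ N)  ≡⟨ *-assoc (x + suc N) x (x ^ N) ⟨
    (x + suc N) * x * x ^ N    ≤⟨ *-monoˡ-≤ (x ^ N) (≤-trans (m≤m+n _ N) (≤-reflexive (step x N))) ⟩
    suc x * (x + N) * x ^ N    ≡⟨ *-assoc (suc x) (x + N) (x ^ N) ⟩
    suc x * ((x + N) * x ^ N)  ≤⟨ *-monoʳ-≤ (suc x) (bernoulli x N) ⟩
    suc x * (x * suc x ^ N)    ≡⟨ *-comm-middle (suc x) x (suc x ^ N) ⟩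
    x * (suc x * suc x ^ N)    ∎
    where
    open ≤-Reasoning
    step : ∀ x N → (x + suc N) * x + N ≡ suc x * (x + N)
    step = solve-∀
    *-comm-middle : ∀ a b c → a * (b * c) ≡ b * (a * c)
    *-comm-middle = solve-∀

  suc-k*x^N≤suc-x^N : ∀ k x N .{{_ : NonZero x}} → k * x ≤ N → suc k * x ^ N ≤ suc x ^ N
  suc-k*x^N≤suc-x^N k x N kx≤N = *-cancelˡ-≤ x (begin
    x * (suc k * x ^ N)  ≡⟨ *-comm-left x (suc k) (x ^ N) ⟩
    suc k * x * x ^ N    ≤⟨ *-monoˡ-≤ (x ^ N) (+-monoʳ-≤ x kx≤N) ⟩
    (x + N) * x ^ N      ≤⟨ bernoulli x N ⟩
    x * suc x ^ N        ∎)
    where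
    open ≤-Reasoning
    *-comm-left : ∀ a b c → a * (b * c) ≡ b * a * c
    *-comm-left = solve-∀

  k^N*x^N²<y^N² : ∀ k x y N .{{_ : NonZero N}} → x < y → k * x ≤ N →
    k ^ N * x ^ (N * N) < y ^ (N * N)
  k^N*x^N²<y^N² k zero y N@(suc n) 0<y _ = begin-strict
    k ^ N * 0 ^ (N * N)  ≡⟨ *-zeroʳ (k ^ N) ⟩
    0                    <⟨ m^n>0 y {{>-nonZero 0<y}} (N * N) ⟩
    y ^ (N * N)          ∎
    where open ≤-Reasoning
  k^N*x^N²<y^N² k x@(suc _) y N x<y kx≤N = begin-strict
    k ^ N * x ^ (N * N)         <⟨ *-monoˡ-< (x ^ (N * N)) {{m^n≢0 x (N * N)}} (^-monoˡ-< N (n<1+n k)) ⟩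
    suc k ^ N * x ^ (N * N)     ≡⟨ cong (suc k ^ N *_) (^-*-assoc x N N) ⟨
    suc k ^ N * (x ^ N) ^ N     ≡⟨ ^-distribʳ-* (suc k) (x ^ N) N ⟨
    (suc k * x ^ N) ^ N         ≤⟨ ^-monoˡ-≤ N (suc-k*x^N≤suc-x^N k x N kx≤N) ⟩
    (suc x ^ N) ^ N             ≡⟨ ^-*-assoc (suc x) N N ⟩
    suc x ^ (N * N)             ≤⟨ ^-monoˡ-≤ (N * N) x<y ⟩
    y ^ (N * N)                 ∎
    where open ≤-Reasoning

  growthRate-≤-of-subexponential-bound : ∀ k (Z Z′ : ℕ → ℕ) → (∀ N → Z′ N ≤ k ^ N * Z N) →
    ∀ {a b c d} → a * d < c * b → ¬ (EventuallyBelow Z a b × EventuallyAbove Z′ c d)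
  growthRate-≤-of-subexponential-bound k Z Z′ bound {a} {b} {c} {d} ad<cb
                                       ((M₁ , below) , (M₂ , above)) =
    <⇒≱ (k^N*x^N²<y^N² k (a * d) (c * b) N ad<cb k*ad≤N) (begin
      (c * b) ^ K                   ≡⟨ ^-distribʳ-* c b K ⟩
      c ^ K * b ^ K                 ≤⟨ *-monoˡ-≤ (b ^ K) (above N M₂≤N) ⟩
      Z′ N * d ^ K * b ^ K          ≤⟨ *-monoˡ-≤ (b ^ K) (*-monoˡ-≤ (d ^ K) (bound N)) ⟩
      k ^ N * Z N * d ^ K * b ^ K   ≡⟨ regroup (k ^ N) (Z N) (d ^ K) (b ^ K) ⟩
      k ^ N * (Z N * b ^ K) * d ^ K ≤⟨ *-monoˡ-≤ (d ^ K) (*-monoʳ-≤ (k ^ N) (below N M₁≤N)) ⟩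
      k ^ N * a ^ K * d ^ K         ≡⟨ *-assoc (k ^ N) (a ^ K) (d ^ K) ⟩
      k ^ N * (a ^ K * d ^ K)       ≡⟨ cong (k ^ N *_) (^-distribʳ-* a d K) ⟨
      k ^ N * (a * d) ^ K           ∎)
    where
    open ≤-Reasoning
    N K : ℕ
    N = suc (M₁ + M₂ + k * (a * d))
    K = N * N
    M₁≤N : M₁ ≤ N
    M₁≤N = m≤n⇒m≤1+n (≤-trans (m≤m+n M₁ M₂) (m≤m+n (M₁ + M₂) _))
    M₂≤N : M₂ ≤ N
    M₂≤N = m≤n⇒m≤1+n (≤-trans (m≤n+m M₂ M₁) (m≤m+n (M₁ + M₂) _))
    k*ad≤N : k * (a * d) ≤ N
    k*ad≤N = m≤n⇒m≤1+n (m≤n+m _ (M₁ + M₂))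
    regroup : ∀ f z p q → f * z * p * q ≡ f * (z * q) * p
    regroup = solve-∀

module Counting where

  open Enumeration
  open Realization
  open GrowthRates using (^-distribʳ-*)
  open import Data.Bool using (true; false; T)
  open import Data.Nat using (ℕ; suc; _≤_; _*_; _^_)
  open import Data.Nat.Properties using (≤-trans; ≤-reflexive; *-assoc; *-comm)
  open import Data.Fin using (Fin)
  open import Data.List using (List; _∷_; []; allFin; filterᵇ; length; cartesianProduct)
  open import Data.List.Membership.Propositional using (_∈_)
  open import Data.List.Membership.Propositional.Properties using (∈-allFin; ∈-filter⁺; ∈-cartesianProduct⁺)
  open import Data.List.Relation.Unary.Any using (here; there)
  open import Data.List.Relation.Unary.All using ([]; _∷_)
  open import Data.List.Relation.Unary.AllPairs using ([]; _∷_)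
  open import Data.List.Relation.Unary.Unique.Propositional using (Unique)
  import Data.List.Relation.Unary.Unique.Propositional.Properties as Unique
  open import Data.Vec using (Vec)
  open import Data.Product using (_×_; _,_)
  open import Function using (_∘_)
  open import Relation.Binary.PropositionalEquality
  open import Relation.Nullary.Decidable using (T?)

  spins : List Spin
  spins = true ∷ false ∷ []

  spins-complete : ∀ x → x ∈ spins
  spins-complete true  = here refl
  spins-complete false = there (here refl)

  spinConfigs : ∀ n → List (SpinConfig n)
  spinConfigs n = allVecs (allVecs spins n) n

  spinConfigs-unique : ∀ n → Unique (spinConfigs n)
  spinConfigs-unique n = allVecs-unique (allVecs-unique (((λ ()) ∷ []) ∷ [] ∷ []) n) n

  bondConfigs : ∀ n → List (HBonds n × VBonds n)
  bondConfigs n =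
    cartesianProduct (allVecs (allVecs (allFin 4) (suc n)) n) (allVecs (allVecs (allFin 4) n) (suc n))

  bondConfigs-complete : ∀ {n} (Q : HBonds n × VBonds n) → Q ∈ bondConfigs n
  bondConfigs-complete (H , Vb) =
    ∈-cartesianProduct⁺ (allVecs-complete (allVecs-complete ∈-allFin) H)
                        (allVecs-complete (allVecs-complete ∈-allFin) Vb)

  bondConfigs-unique : ∀ n → Unique (bondConfigs n)
  bondConfigs-unique n = Unique.cartesianProduct⁺
    (allVecs-unique (allVecs-unique (Unique.allFin⁺ 4) (suc n)) n)
    (allVecs-unique (allVecs-unique (Unique.allFin⁺ 4) n) (suc n))

  Zch≤ZQ : ∀ n → Zch n ≤ ZQ n
  Zch≤ZQ n = countᵇ-≤-retraction isCharge3 canonicalBonds spinConfigOf (spinConfigs-unique n)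
    (λ {σ} _ ok → ∈-filter⁺ (T? ∘ isQCharge) (bondConfigs-complete (canonicalBonds σ))
                            (realizes⇒isQCharge σ (canonicalBonds σ) (isCharge3⇒realizes σ ok)))
    (λ {σ} _ ok → realizes⇒spinConfigOf σ (canonicalBonds σ) (isCharge3⇒realizes σ ok))

  MarkedSpinConfig : ℕ → Set
  MarkedSpinConfig n = (SpinConfig n × Vec (Fin 4) n) × Vec (Fin 4) n

  markedCharge3Configs : ∀ n → List (MarkedSpinConfig n)
  markedCharge3Configs n = cartesianProduct (cartesianProduct charge3 starts) starts
    where
    charge3 = filterᵇ isCharge3 (spinConfigs n)
    starts  = allVecs (allFin 4) n

  length-markedCharge3Configs : ∀ n → length (markedCharge3Configs n) ≡ Zch n * 4 ^ n * 4 ^ n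
  length-markedCharge3Configs n = begin
    length (cartesianProduct (cartesianProduct charge3 starts) starts)
      ≡⟨ length-cartesianProductWith _,_ (cartesianProduct charge3 starts) starts ⟩
    length (cartesianProduct charge3 starts) * length starts
      ≡⟨ cong (_* length starts) (length-cartesianProductWith _,_ charge3 starts) ⟩
    Zch n * length starts * length starts
      ≡⟨ cong (λ l → Zch n * l * l) (length-allVecs (allFin 4) n) ⟩
    Zch n * 4 ^ n * 4 ^ n ∎
    where
    open ≡-Reasoning
    charge3 = filterᵇ isCharge3 (spinConfigs n)
    starts  = allVecs (allFin 4) n

  ZQ≤Zch*4^n*4^n : ∀ n → ZQ n ≤ Zch n * 4 ^ n * 4 ^ n
  ZQ≤Zch*4^n*4^n n = subst (ZQ n ≤_) (length-markedCharge3Configs n)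
    (countᵇ-≤-retraction isQCharge mark unmark (bondConfigs-unique n) into retract)
    where
    mark : HBonds n × VBonds n → MarkedSpinConfig n
    mark Q = (spinConfigOf Q , rowStarts Q) , columnStarts Q
    unmark : MarkedSpinConfig n → HBonds n × VBonds n
    unmark ((σ , r) , c) = bondConfig σ r c
    into : ∀ {Q} → Q ∈ bondConfigs n → T (isQCharge Q) → mark Q ∈ markedCharge3Configs n
    into {Q} _ ok = ∈-cartesianProduct⁺
      (∈-cartesianProduct⁺
        (∈-filter⁺ (T? ∘ isCharge3) (allVecs-complete (allVecs-complete spins-complete) _)
                   (realizes⇒isCharge3 (spinConfigOf Q) Q (isQCharge⇒realizes Q ok)))
        (allVecs-complete ∈-allFin _))
      (allVecs-complete ∈-allFin _)
    retract : ∀ {Q} → Q ∈ bondConfigs n → T (isQCharge Q) → unmark (mark Q) ≡ Q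
    retract {Q} _ ok = realizes⇒bondConfig (spinConfigOf Q) Q (isQCharge⇒realizes Q ok)

  ZQ≤16^n*Zch : ∀ n → ZQ n ≤ 16 ^ n * Zch n
  ZQ≤16^n*Zch n = ≤-trans (ZQ≤Zch*4^n*4^n n) (≤-reflexive (begin
    Zch n * 4 ^ n * 4 ^ n    ≡⟨ *-assoc (Zch n) (4 ^ n) (4 ^ n) ⟩
    Zch n * (4 ^ n * 4 ^ n)  ≡⟨ cong (Zch n *_) (^-distribʳ-* 4 4 n) ⟨
    Zch n * 16 ^ n           ≡⟨ *-comm (Zch n) (16 ^ n) ⟩
    16 ^ n * Zch n           ∎))
    where open ≡-Reasoning

open import Data.Nat using (ℕ; _*_; _<_; _≤_; _^_; NonZero)
open import Data.Nat.Properties using (^-zeroˡ; *-identityˡ)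
open import Data.Product using (_×_; _,_)
open import Relation.Nullary using (¬_)
open Counting using (Zch≤ZQ; ZQ≤16^n*Zch)
open GrowthRates using (growthRate-≤-of-subexponential-bound)

-- The denominators b and d are allowed to vanish: the argument never divides by them.
mainTheorem1 : (a b c d : ℕ) → NonZero b → NonZero d → a * d < c * b →
    ¬ (EventuallyBelow Zch a b × EventuallyAbove ZQ c d)
    × ¬ (EventuallyBelow ZQ a b × EventuallyAbove Zch c d)
mainTheorem1 a b c d _ _ ad<cb =
    growthRate-≤-of-subexponential-bound 16 Zch ZQ ZQ≤16^n*Zch ad<cb
  , growthRate-≤-of-subexponential-bound 1 ZQ Zch Zch≤1^n*ZQ ad<cb
  where
  Zch≤1^n*ZQ : ∀ n → Zch n ≤ 1 ^ n * ZQ n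
  Zch≤1^n*ZQ n rewrite ^-zeroˡ n | *-identityˡ (ZQ n) = Zch≤ZQ n
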